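{- Let $L_0$ be a finite co-Heyting algebra, $L$ an extension of $L_0$, and $(x_1,x_2)\in L^2$ a tuple primitive over $L_0$, with $g\in\mathcal J(L_0)$ as in the definition of primitivity. Then $g=g(x_1,L_0)=g(x_2,L_0)$.
   Context: A co-Heyting algebra is a bounded distributive lattice $(L,\mathbf{0},\mathbf{1},\vee,\wedge)$ with a binary operation $-$ such that $a-b$ is the least $c\in L$ with $a\le b\vee c$; extensions are in the language $\{\mathbf 0,\mathbf 1,\vee,\wedge,-\}$. Write $b\ll a$ iff $a-b=a$ and $b\le a$. An element $a$ is join irreducible if it is not the join of any finite subset not containing $a$; $\mathcal J(L)$ denotes the set of join irreducible elements. For $a\in L_0$, $a^-=\bigvee\{b\in L_0:b<a\}$; for $x\in L$, $g(x,L_0)=\bigwedge\{a\in L_0:x\le a\}$. A tuple $(x_1,x_2)\in L^2$ is primitive over $L_0$ if $x_1,x_2\notin L_0$ and there is $g\in\mathcal J(L_0)$ such that $g^-\wedge x_1,\ g^-\wedge x_2\in L_0$ and either ($x_1=x_2$ and $g^-\wedge x_1\ll x_1\ll g$) or ($x_1\ne x_2$, $x_1\wedge x_2\in L_0$, $g-x_1=x_2$ and $g-x_2=x_1$). -}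

module Defs where

open import Data.Product using (Σ; _×_; _,_)
open import Data.Sum using (_⊎_)
open import Data.List using (List; foldr)
open import Data.List.Relation.Unary.All using (All)
open import Data.List.Membership.Propositional using (_∈_)
open import Relation.Binary.PropositionalEquality using (_≡_)
open import Relation.Nullary using (¬_)

record CoHeytingAlgebra : Set₁ where
  infixr 6 _∨_
  infixr 7 _∧_
  infixl 8 _-_
  infix 4 _≤_
  field
    Carrier : Set
    𝟎 𝟏 : Carrier
    _∨_ _∧_ _-_ : Carrier → Carrier → Carrier
    ∨-assoc : ∀ a b c → (a ∨ b) ∨ c ≡ a ∨ (b ∨ c)
    ∧-assoc : ∀ a b c → (a ∧ b) ∧ c ≡ a ∧ (b ∧ c)
    ∨-comm : ∀ a b → a ∨ b ≡ b ∨ a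
    ∧-comm : ∀ a b → a ∧ b ≡ b ∧ a
    ∨-absorbs-∧ : ∀ a b → a ∨ (a ∧ b) ≡ a
    ∧-absorbs-∨ : ∀ a b → a ∧ (a ∨ b) ≡ a
    ∧-distrib-∨ : ∀ a b c → a ∧ (b ∨ c) ≡ (a ∧ b) ∨ (a ∧ c)
    ∨-identity : ∀ a → a ∨ 𝟎 ≡ a
    ∧-identity : ∀ a → a ∧ 𝟏 ≡ a

  _≤_ : Carrier → Carrier → Set
  a ≤ b = a ∧ b ≡ a

  field
    diff-upper : ∀ a b → a ≤ b ∨ (a - b)
    diff-least : ∀ a b c → a ≤ b ∨ c → a - b ≤ c

  _<_ : Carrier → Carrier → Set
  a < b = a ≤ b × ¬ (a ≡ b)

  _≪_ : Carrier → Carrier → Set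
  b ≪ a = (a - b ≡ a) × (b ≤ a)

  ⋁ : List Carrier → Carrier
  ⋁ = foldr _∨_ 𝟎

  IsJoin : (Carrier → Set) → Carrier → Set
  IsJoin P u = (∀ b → P b → b ≤ u) × (∀ c → (∀ b → P b → b ≤ c) → u ≤ c)

  IsMeet : (Carrier → Set) → Carrier → Set
  IsMeet P m = (∀ a → P a → m ≤ a) × (∀ c → (∀ a → P a → c ≤ a) → c ≤ m)

-- A subalgebra L₀ of L (so L is an extension of L₀), given as a subset of
-- the carrier of L closed under 𝟎, 𝟏, ∨, ∧, -.
record Subalgebra (L : CoHeytingAlgebra) : Set₁ where
  open CoHeytingAlgebra L
  field
    In : Carrier → Set
    In-𝟎 : In 𝟎
    In-𝟏 : In 𝟏
    In-∨ : ∀ {a b} → In a → In b → In (a ∨ b)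
    In-∧ : ∀ {a b} → In a → In b → In (a ∧ b)
    In-- : ∀ {a b} → In a → In b → In (a - b)

module _ {L : CoHeytingAlgebra} (L₀ : Subalgebra L) where
  open CoHeytingAlgebra L
  open Subalgebra L₀

  IsFinite : Set
  IsFinite = Σ (List Carrier) λ xs → ∀ a → In a → a ∈ xs

  JoinIrreducible : Carrier → Set
  JoinIrreducible a = In a × (∀ (xs : List Carrier) → All In xs → a ≡ ⋁ xs → a ∈ xs)

  -- gm is a⁻ = ⋁ {b ∈ L₀ : b < a}
  IsMinus : Carrier → Carrier → Set
  IsMinus a gm = IsJoin (λ b → In b × b < a) gm

  -- m is g(x, L₀) = ⋀ {a ∈ L₀ : x ≤ a}
  IsGen : Carrier → Carrier → Set
  IsGen x m = IsMeet (λ a → In a × x ≤ a) m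

  PrimitiveWith : Carrier → Carrier → Carrier → Carrier → Set
  PrimitiveWith x₁ x₂ g gm =
    ¬ In x₁ × ¬ In x₂ × JoinIrreducible g × IsMinus g gm ×
    In (gm ∧ x₁) × In (gm ∧ x₂) ×
    ( (x₁ ≡ x₂ × (gm ∧ x₁) ≪ x₁ × x₁ ≪ g)
    ⊎ (¬ (x₁ ≡ x₂) × In (x₁ ∧ x₂) × g - x₁ ≡ x₂ × g - x₂ ≡ x₁))

-- Every a ∈ L₀ splits g as (g ∧ a) ∨ (g - a), so a join irreducible g satisfies
-- g ≤ a or g = g - a. For x ≤ g with x ∉ L₀ and g⁻ ∧ x ∈ L₀, the second case is
-- impossible when x ≤ a: g ∧ a would be an element of L₀ strictly below g, hence
-- below g⁻, and then x = g⁻ ∧ x ∈ L₀. So g is the least element of L₀ above x.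
-- Primitivity gives x₁, x₂ ≤ g, either directly (x₁ ≪ g) or as x₁ = g - x₂.
module Submission where

open import Defs
open import Data.Product using (_×_; _,_)
open import Data.Sum using (_⊎_; inj₁; inj₂)
open import Data.Empty using (⊥-elim)
open import Data.List using ([]; _∷_)
open import Data.List.Relation.Unary.All using ([]; _∷_)
open import Data.List.Relation.Unary.Any using (here; there)
open import Relation.Binary.PropositionalEquality
  using (_≡_; refl; sym; trans; cong; subst; module ≡-Reasoning)
open import Relation.Nullary using (¬_)

module CoHeytingProperties (L : CoHeytingAlgebra) where
  open CoHeytingAlgebra L
  open ≡-Reasoning

  ≤-trans : ∀ {a b c} → a ≤ b → b ≤ c → a ≤ c
  ≤-trans {a} {b} {c} a≤b b≤c = begin
    a ∧ c        ≡⟨ cong (_∧ c) (sym a≤b) ⟩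
    (a ∧ b) ∧ c  ≡⟨ ∧-assoc a b c ⟩
    a ∧ (b ∧ c)  ≡⟨ cong (a ∧_) b≤c ⟩
    a ∧ b        ≡⟨ a≤b ⟩
    a            ∎

  ∧-idem : ∀ a → a ∧ a ≡ a
  ∧-idem a = trans (cong (a ∧_) (sym (∨-absorbs-∧ a a))) (∧-absorbs-∨ a (a ∧ a))

  ∧-zeroˡ : ∀ a → 𝟎 ∧ a ≡ 𝟎
  ∧-zeroˡ a = trans (cong (𝟎 ∧_) (sym (trans (∨-comm 𝟎 a) (∨-identity a))))
                    (∧-absorbs-∨ 𝟎 a)

  x≤𝟎⇒x≡𝟎 : ∀ {x} → x ≤ 𝟎 → x ≡ 𝟎
  x≤𝟎⇒x≡𝟎 {x} x≤𝟎 = trans (sym x≤𝟎) (trans (∧-comm x 𝟎) (∧-zeroˡ x))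

  x∧y≤x : ∀ x y → x ∧ y ≤ x
  x∧y≤x x y = begin
    (x ∧ y) ∧ x  ≡⟨ ∧-assoc x y x ⟩
    x ∧ (y ∧ x)  ≡⟨ cong (x ∧_) (∧-comm y x) ⟩
    x ∧ (x ∧ y)  ≡⟨ sym (∧-assoc x x y) ⟩
    (x ∧ x) ∧ y  ≡⟨ cong (_∧ y) (∧-idem x) ⟩
    x ∧ y        ∎

  ∧-greatest : ∀ {x a b} → x ≤ a → x ≤ b → x ≤ a ∧ b
  ∧-greatest {x} {a} {b} x≤a x≤b =
    trans (sym (∧-assoc x a b)) (trans (cong (_∧ b) x≤a) x≤b)

  x≤y∨x : ∀ x y → x ≤ y ∨ x
  x≤y∨x x y = trans (cong (x ∧_) (∨-comm y x)) (∧-absorbs-∨ x y)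

  a-b≤a : ∀ a b → a - b ≤ a
  a-b≤a a b = diff-least a b a (x≤y∨x a b)

  a≤b⇒a-b≡𝟎 : ∀ {a b} → a ≤ b → a - b ≡ 𝟎
  a≤b⇒a-b≡𝟎 {a} {b} a≤b = x≤𝟎⇒x≡𝟎 (diff-least a b 𝟎 (trans (cong (a ∧_) (∨-identity b)) a≤b))

  ≡∧∨- : ∀ a b → a ≡ ⋁ ((a ∧ b) ∷ (a - b) ∷ [])
  ≡∧∨- a b = sym (begin
    (a ∧ b) ∨ ((a - b) ∨ 𝟎)  ≡⟨ cong ((a ∧ b) ∨_) (∨-identity (a - b)) ⟩
    (a ∧ b) ∨ (a - b)        ≡⟨ cong ((a ∧ b) ∨_) (sym (trans (∧-comm a (a - b)) (a-b≤a a b))) ⟩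
    (a ∧ b) ∨ (a ∧ (a - b))  ≡⟨ sym (∧-distrib-∨ a b (a - b)) ⟩
    a ∧ (b ∨ (a - b))        ≡⟨ diff-upper a b ⟩
    a                        ∎)

module _ {L : CoHeytingAlgebra} (L₀ : Subalgebra L) where
  open CoHeytingAlgebra L
  open Subalgebra L₀
  open CoHeytingProperties L

  joinIrreducible⇒≤⊎≡- : ∀ {g a} → JoinIrreducible L₀ g → In a → g ≤ a ⊎ g ≡ g - a
  joinIrreducible⇒≤⊎≡- {g} {a} (In-g , irreducible) In-a
    with irreducible _ (In-∧ In-g In-a ∷ In-- In-g In-a ∷ []) (≡∧∨- g a)
  ... | here g≡g∧a         = inj₁ (sym g≡g∧a)
  ... | there (here g≡g-a) = inj₂ g≡g-a

  <⇒≤minus : ∀ {g gm b} → IsMinus L₀ g gm → In b → b ≤ g → ¬ b ≡ g → b ≤ gm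
  <⇒≤minus (upper , _) In-b b≤g b≢g = upper _ (In-b , b≤g , b≢g)

  ≤joinIrreducible⇒isGen : ∀ {x g gm} → JoinIrreducible L₀ g → IsMinus L₀ g gm →
                           In (gm ∧ x) → ¬ In x → x ≤ g → IsGen L₀ x g
  ≤joinIrreducible⇒isGen {x} {g} {gm} irr@(In-g , _) minus In-gm∧x x∉L₀ x≤g =
    g≤upperBound , λ c c≤upperBounds → c≤upperBounds g (In-g , x≤g)
    where
    g≤upperBound : ∀ a → In a × x ≤ a → g ≤ a
    g≤upperBound a (In-a , x≤a) with joinIrreducible⇒≤⊎≡- irr In-a
    ... | inj₁ g≤a   = g≤a
    ... | inj₂ g≡g-a = ⊥-elim (x∉L₀ (subst In gm∧x≡x In-gm∧x))
      where
      g∧a≢g : ¬ g ∧ a ≡ g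
      g∧a≢g g≤a = x∉L₀ (subst In (sym (x≤𝟎⇒x≡𝟎 (subst (x ≤_) g≡𝟎 x≤g))) In-𝟎)
        where
        g≡𝟎 : g ≡ 𝟎
        g≡𝟎 = trans g≡g-a (a≤b⇒a-b≡𝟎 g≤a)

      x≤gm : x ≤ gm
      x≤gm = ≤-trans (∧-greatest x≤g x≤a)
                     (<⇒≤minus minus (In-∧ In-g In-a) (x∧y≤x g a) g∧a≢g)

      gm∧x≡x : gm ∧ x ≡ x
      gm∧x≡x = trans (∧-comm gm x) x≤gm

  primitive⇒≤ : ∀ {x₁ x₂ g gm} → PrimitiveWith L₀ x₁ x₂ g gm → x₁ ≤ g × x₂ ≤ g
  primitive⇒≤ (_ , _ , _ , _ , _ , _ , inj₁ (refl , _ , (_ , x₁≤g))) = x₁≤g , x₁≤g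
  primitive⇒≤ {x₁} {x₂} {g} (_ , _ , _ , _ , _ , _ , inj₂ (_ , _ , g-x₁≡x₂ , g-x₂≡x₁)) =
    subst (_≤ g) g-x₂≡x₁ (a-b≤a g x₂) , subst (_≤ g) g-x₁≡x₂ (a-b≤a g x₁)

lemma3p2 : (L : CoHeytingAlgebra) (L₀ : Subalgebra L) → IsFinite L₀ →
    (x₁ x₂ g gm : CoHeytingAlgebra.Carrier L) →
    PrimitiveWith L₀ x₁ x₂ g gm →
    IsGen L₀ x₁ g × IsGen L₀ x₂ g
lemma3p2 L L₀ _ x₁ x₂ g gm prim@(x₁∉L₀ , x₂∉L₀ , irr , minus , In-gm∧x₁ , In-gm∧x₂ , _)
  with primitive⇒≤ L₀ prim
... | x₁≤g , x₂≤g =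
  ≤joinIrreducible⇒isGen L₀ irr minus In-gm∧x₁ x₁∉L₀ x₁≤g ,
  ≤joinIrreducible⇒isGen L₀ irr minus In-gm∧x₂ x₂∉L₀ x₂≤g
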